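{- Let $X=MD(G,S_0,S_1,T_0,T_1)$ be max-$\lambda$ but not super-$\lambda$, and let $A$ be a $\lambda$-superatom of $X$. If $\delta(X)=1$, then $A\cap X_i\neq\varnothing$ for $i=0,1$.
   Context: $G$ is a finite group with identity $1_G$, $S_0,S_1\subseteq G\setminus\{1_G\}$, $T_0,T_1\subseteq G$. The mixed Cayley digraph $X=MD(G,S_0,S_1,T_0,T_1)$ has vertex set $G\times\{0,1\}$ and arcs $((g,i),(sg,i))$ for $g\in G$, $s\in S_i$, $i=0,1$; $((g,0),(tg,1))$ for $g\in G$, $t\in T_0$; and $((tg,1),(g,0))$ for $g\in G$, $t\in T_1$; $X_i=G\times\{i\}$. $\delta(X)$ is the minimum over all vertices of all in-degrees and out-degrees; $\lambda(X)$ is the arc-connectivity (minimum number of arcs whose removal leaves a non-strongly-connected digraph). For $A\subseteq V(X)$, $\omega^+(A)$ (resp. $\omega^-(A)$) is the set of arcs from $A$ to $V(X)\setminus A$ (resp. from $V(X)\setminus A$ to $A$). A proper nonempty $A$ is a positive (resp. negative) arc fragment if $|\omega^+(A)|=\lambda(X)$ (resp. $|\omega^-(A)|=\lambda(X)$); an arc fragment is either of these. A $\lambda$-superatom is an arc fragment with at least two vertices of least possible cardinality among such. $X$ is max-$\lambda$ if $\lambda(X)=\delta(X)$, and super-$\lambda$ if every minimum cut (a set $\omega^+(A)$, $A$ proper nonempty, of cardinality $\lambda(X)$) is the set of all inarcs of some vertex or the set of all outarcs of some vertex. -}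

module Defs where

open import Data.Nat using (ℕ; _≤_)
open import Data.Bool using (Bool; true; false; _∧_; not; if_then_else_)
open import Data.Fin using (Fin)
open import Data.Fin.Subset using (Subset)
open import Data.Vec using (lookup)
open import Data.List using (List; []; _∷_; length; filterᵇ; allFin; concatMap; cartesianProduct)
open import Data.Product using (Σ; _×_; _,_; ∃; proj₁; proj₂)
open import Data.Sum using (_⊎_)
open import Relation.Binary.PropositionalEquality using (_≡_)
open import Relation.Nullary using (¬_)
open import Algebra.Structures using (IsGroup)

-- A finite group of order n, represented on the carrier Fin n with
-- propositional equality (every finite group is isomorphic to one of these).

record FinGroup (n : ℕ) : Set where
  field
    _∙_   : Fin n → Fin n → Fin n
    ε     : Fin n
    _⁻¹   : Fin n → Fin n
    isGroup : IsGroup _≡_ _∙_ ε _⁻¹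

record MixedCayleyData (n : ℕ) : Set where
  field
    G  : FinGroup n
    S₀ : Subset n
    S₁ : Subset n
    T₀ : Subset n
    T₁ : Subset n
  open FinGroup G public
  field
    ε∉S₀ : lookup S₀ ε ≡ false
    ε∉S₁ : lookup S₁ ε ≡ false

-- Vertices: G × {0,1}; the Bool component is the layer (false = 0, true = 1).
Vertex : ℕ → Set
Vertex n = Fin n × Bool

vertices : (n : ℕ) → List (Vertex n)
vertices n = concatMap (λ g → (g , false) ∷ (g , true) ∷ []) (allFin n)

-- Arc relation of MD(G,S₀,S₁,T₀,T₁):
--   (g,i) → (s g, i)  for s ∈ Sᵢ         i.e. (g,i) → (h,i) iff h g⁻¹ ∈ Sᵢ
--   (g,0) → (t g, 1)  for t ∈ T₀         i.e. (g,0) → (h,1) iff h g⁻¹ ∈ T₀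
--   (t g,1) → (g, 0)  for t ∈ T₁         i.e. (h,1) → (g,0) iff h g⁻¹ ∈ T₁
-- (The digraph is simple, so arcs are given by a Boolean relation.)
Arc : ∀ {n} → MixedCayleyData n → Vertex n → Vertex n → Bool
Arc X (g , false) (h , false) = lookup (MixedCayleyData.S₀ X) (MixedCayleyData._∙_ X h (MixedCayleyData._⁻¹ X g))
Arc X (g , true)  (h , true)  = lookup (MixedCayleyData.S₁ X) (MixedCayleyData._∙_ X h (MixedCayleyData._⁻¹ X g))
Arc X (g , false) (h , true)  = lookup (MixedCayleyData.T₀ X) (MixedCayleyData._∙_ X h (MixedCayleyData._⁻¹ X g))
Arc X (h , true)  (g , false) = lookup (MixedCayleyData.T₁ X) (MixedCayleyData._∙_ X h (MixedCayleyData._⁻¹ X g))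

countPairs : ∀ {n} → (Vertex n → Vertex n → Bool) → ℕ
countPairs {n} R = length (filterᵇ (λ p → R (proj₁ p) (proj₂ p)) (cartesianProduct (vertices n) (vertices n)))

outdeg : ∀ {n} → (Vertex n → Vertex n → Bool) → Vertex n → ℕ
outdeg {n} E v = length (filterᵇ (λ w → E v w) (vertices n))

indeg : ∀ {n} → (Vertex n → Vertex n → Bool) → Vertex n → ℕ
indeg {n} E v = length (filterᵇ (λ u → E u v) (vertices n))

data Reach {n} (E : Vertex n → Vertex n → Bool) : Vertex n → Vertex n → Set where
  here : ∀ {u} → Reach E u u
  step : ∀ {u w v} → E u w ≡ true → Reach E w v → Reach E u v

StronglyConnected : ∀ {n} → (Vertex n → Vertex n → Bool) → Set
StronglyConnected E = ∀ u v → Reach E u v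

removeArcs : ∀ {n} → MixedCayleyData n → (Vertex n → Vertex n → Bool) → Vertex n → Vertex n → Bool
removeArcs X F u v = Arc X u v ∧ not (F u v)

arcsIn : ∀ {n} → MixedCayleyData n → (Vertex n → Vertex n → Bool) → ℕ
arcsIn X F = countPairs (λ u v → Arc X u v ∧ F u v)

IsArcConnectivity : ∀ {n} → MixedCayleyData n → ℕ → Set
IsArcConnectivity X k =
  (Σ (_ → _ → Bool) λ F → arcsIn X F ≡ k × ¬ StronglyConnected (removeArcs X F))
  × (∀ F → ¬ StronglyConnected (removeArcs X F) → k ≤ arcsIn X F)

IsMinDegree : ∀ {n} → MixedCayleyData n → ℕ → Set
IsMinDegree {n} X d =
  (Σ (Vertex n) λ v → indeg (Arc X) v ≡ d ⊎ outdeg (Arc X) v ≡ d)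
  × (∀ v → d ≤ indeg (Arc X) v × d ≤ outdeg (Arc X) v)

VSet : ℕ → Set
VSet n = Vertex n → Bool

card : ∀ {n} → VSet n → ℕ
card {n} A = length (filterᵇ A (vertices n))

ProperNonempty : ∀ {n} → VSet n → Set
ProperNonempty {n} A = (Σ (Vertex n) λ u → A u ≡ true) × (Σ (Vertex n) λ v → A v ≡ false)

ω⁺ : ∀ {n} → MixedCayleyData n → VSet n → Vertex n → Vertex n → Bool
ω⁺ X A u v = Arc X u v ∧ A u ∧ not (A v)

ω⁻ : ∀ {n} → MixedCayleyData n → VSet n → Vertex n → Vertex n → Bool
ω⁻ X A u v = Arc X u v ∧ not (A u) ∧ A v

arcCount : ∀ {n} → (Vertex n → Vertex n → Bool) → ℕ
arcCount = countPairs

IsPositiveArcFragment : ∀ {n} → MixedCayleyData n → ℕ → VSet n → Set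
IsPositiveArcFragment X k A = ProperNonempty A × arcCount (ω⁺ X A) ≡ k

IsNegativeArcFragment : ∀ {n} → MixedCayleyData n → ℕ → VSet n → Set
IsNegativeArcFragment X k A = ProperNonempty A × arcCount (ω⁻ X A) ≡ k

IsArcFragment : ∀ {n} → MixedCayleyData n → ℕ → VSet n → Set
IsArcFragment X k A = IsPositiveArcFragment X k A ⊎ IsNegativeArcFragment X k A

IsLambdaSuperatom : ∀ {n} → MixedCayleyData n → ℕ → VSet n → Set
IsLambdaSuperatom X k A =
  IsArcFragment X k A × 2 ≤ card A
  × (∀ B → IsArcFragment X k B → 2 ≤ card B → card A ≤ card B)

IsAllInarcsOf : ∀ {n} → MixedCayleyData n → (Vertex n → Vertex n → Bool) → Vertex n → Set
IsAllInarcsOf X R w = ∀ u v → (R u v ≡ true → Arc X u v ≡ true × v ≡ w)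
                             × (Arc X u v ≡ true × v ≡ w → R u v ≡ true)

IsAllOutarcsOf : ∀ {n} → MixedCayleyData n → (Vertex n → Vertex n → Bool) → Vertex n → Set
IsAllOutarcsOf X R w = ∀ u v → (R u v ≡ true → Arc X u v ≡ true × u ≡ w)
                              × (Arc X u v ≡ true × u ≡ w → R u v ≡ true)

IsMaxLambda : ℕ → ℕ → Set
IsMaxLambda k d = k ≡ d

IsSuperLambda : ∀ {n} → MixedCayleyData n → ℕ → Set
IsSuperLambda {n} X k =
  ∀ A → ProperNonempty A → arcCount (ω⁺ X A) ≡ k →
  Σ (Vertex n) λ w → IsAllInarcsOf X (ω⁺ X A) w ⊎ IsAllOutarcsOf X (ω⁺ X A) w

-- For δ(X) = 1 the superatom A is a fragment with λ(X) = 1, so |ω⁺(A)| = 1 or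
-- |ω⁻(A)| = 1, and λ(X) ≥ 1 makes X strongly connected. Strong connectivity
-- forces both T₀ and T₁ to be nonempty, since a walk between the layers must
-- use an arc of each kind. Fixing t₀ ∈ T₀ and t₁ ∈ T₁, every vertex of one
-- layer has an out-neighbour and an in-neighbour in the other layer. If A lay
-- inside a single layer, each of its (at least two) vertices would therefore
-- contribute its own arc to ω⁺(A) and to ω⁻(A), so both cuts would have at
-- least two arcs.
module Submission where

open import Defs
open import Data.Nat using (ℕ; _≤_; s≤s; z≤n)
open import Data.Nat.Properties using (m≤n⇒m≤1+n; ≤-trans; n≮0)
open import Data.Bool using (Bool; true; false; not; T; T?; _≟_)
open import Data.Bool.Properties using (T-≡; ¬-not; ∧-zeroʳ; ∧-identityʳ)
open import Data.Product using (Σ; ∃₂; _×_; _,_; proj₁; proj₂)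
open import Data.Sum using (inj₁; inj₂)
open import Data.Fin using (Fin)
open import Data.Fin.Subset using (Subset)
open import Data.Fin.Properties using (any?)
open import Data.Empty using (⊥-elim)
open import Data.List using (List; []; _∷_; length; filter; allFin; concatMap; cartesianProduct)
open import Data.List.Properties using (filter-none)
open import Data.List.Membership.Propositional using (_∈_)
open import Data.List.Membership.Propositional.Properties
  using (∈-allFin; ∈-cartesianProduct⁺; ∈-filter⁺; ∈-filter⁻; ∈-length)
open import Data.List.Relation.Unary.Any using (here; there)
open import Data.List.Relation.Unary.All using ([]; _∷_; universal)
open import Data.List.Relation.Unary.AllPairs using ([]; _∷_)
open import Data.List.Relation.Unary.Unique.Propositional using (Unique)
import Data.List.Relation.Unary.Unique.Propositional.Properties as Unique
open import Data.Vec using (lookup)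
open import Function using (_∘_; case_of_; Equivalence)
open import Relation.Binary.PropositionalEquality using (_≡_; _≢_; refl; sym; trans; cong; subst)
open import Relation.Nullary using (¬_; yes; no; contradiction)
open import Algebra.Bundles using (Group)
import Algebra.Properties.Group as GroupProperties

open Equivalence using (to; from)

private
  variable
    A : Set
    x y : A
    xs : List A

distinct-∈⇒2≤length : x ≢ y → x ∈ xs → y ∈ xs → 2 ≤ length xs
distinct-∈⇒2≤length x≢y (here refl) (here refl) = ⊥-elim (x≢y refl)
distinct-∈⇒2≤length x≢y (here refl) (there y∈) = s≤s (∈-length y∈)
distinct-∈⇒2≤length x≢y (there x∈) (here refl) = s≤s (∈-length x∈)
distinct-∈⇒2≤length x≢y (there x∈) (there y∈) = m≤n⇒m≤1+n (distinct-∈⇒2≤length x≢y x∈ y∈)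

Unique∧2≤length⇒distinct : Unique xs → 2 ≤ length xs → ∃₂ λ x y → x ≢ y × x ∈ xs × y ∈ xs
Unique∧2≤length⇒distinct ((x≢y ∷ _) ∷ _) (s≤s (s≤s z≤n)) = _ , _ , x≢y , here refl , there (here refl)

layers : List Bool
layers = false ∷ true ∷ []

vertices≡cartesianProduct : ∀ {n} (gs : List (Fin n)) →
  concatMap (λ g → (g , false) ∷ (g , true) ∷ []) gs ≡ cartesianProduct gs layers
vertices≡cartesianProduct []       = refl
vertices≡cartesianProduct (g ∷ gs) = cong (λ vs → (g , false) ∷ (g , true) ∷ vs) (vertices≡cartesianProduct gs)

vertices-unique : ∀ n → Unique (vertices n)
vertices-unique n = subst Unique (sym (vertices≡cartesianProduct (allFin n)))
  (Unique.cartesianProduct⁺ (Unique.allFin⁺ n) (((λ ()) ∷ []) ∷ [] ∷ []))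

∈-vertices : ∀ {n} (v : Vertex n) → v ∈ vertices n
∈-vertices {n} (g , b) = subst ((g , b) ∈_) (sym (vertices≡cartesianProduct (allFin n)))
  (∈-cartesianProduct⁺ (∈-allFin g) (∈-layers b))
  where
  ∈-layers : ∀ b → b ∈ layers
  ∈-layers false = here refl
  ∈-layers true  = there (here refl)

2≤card⇒distinct : ∀ {n} (S : VSet n) → 2 ≤ card S →
  ∃₂ λ u v → u ≢ v × S u ≡ true × S v ≡ true
2≤card⇒distinct {n} S 2≤|S|
  with u , v , u≢v , u∈ , v∈ ← Unique∧2≤length⇒distinct
         (Unique.filter⁺ (T? ∘ S) {vertices n} (vertices-unique n)) 2≤|S|
  = u , v , u≢v , ∈S u∈ , ∈S v∈
  where
  ∈S : ∀ {w} → w ∈ filter (T? ∘ S) (vertices n) → S w ≡ true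
  ∈S w∈ = to T-≡ (proj₂ (∈-filter⁻ (T? ∘ S) {xs = vertices n} w∈))

distinct⇒2≤countPairs : ∀ {n} (R : Vertex n → Vertex n → Bool) {u v u′ v′} →
  (u , v) ≢ (u′ , v′) → R u v ≡ true → R u′ v′ ≡ true → 2 ≤ countPairs R
distinct⇒2≤countPairs {n} R {u} {v} {u′} {v′} uv≢u′v′ Ruv Ru′v′ =
  distinct-∈⇒2≤length uv≢u′v′
    (∈-filter⁺ P? (∈-pair u v) (from T-≡ Ruv)) (∈-filter⁺ P? (∈-pair u′ v′) (from T-≡ Ru′v′))
  where
  P? = T? ∘ λ (p : Vertex n × Vertex n) → R (proj₁ p) (proj₂ p)
  ∈-pair : ∀ u v → (u , v) ∈ cartesianProduct (vertices n) (vertices n)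
  ∈-pair u v = ∈-cartesianProduct⁺ (∈-vertices u) (∈-vertices v)

countPairs-none : ∀ {n} (R : Vertex n → Vertex n → Bool) → (∀ u v → R u v ≡ false) → countPairs R ≡ 0
countPairs-none {n} R none = cong length
  (filter-none (T? ∘ λ (p : Vertex n × Vertex n) → R (proj₁ p) (proj₂ p))
    {xs = cartesianProduct (vertices n) (vertices n)} (universal (λ (u , v) → subst T (none u v)) _))

MissesLayer : ∀ {n} → VSet n → Bool → Set
MissesLayer S b = ∀ g → S (g , b) ≡ false

other-layer-outside : ∀ {n} (S : VSet n) {b u v} → MissesLayer S b →
  proj₂ v ≡ not (proj₂ u) → S u ≡ true → S v ≡ false
other-layer-outside S {b} {g , c} {h , l} misses l≡¬c g∈S =
  subst (λ l → S (h , l) ≡ false) (trans (¬-not b≢c) (sym l≡¬c)) (misses h)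
  where
  b≢c : b ≢ c
  b≢c refl = contradiction (trans (sym g∈S) (misses g)) λ ()

module _ {n : ℕ} (X : MixedCayleyData n) where
  open MixedCayleyData X

  Nonempty : Subset n → Set
  Nonempty S = Σ (Fin n) λ t → lookup S t ≡ true

  1≤arcConnectivity⇒¬¬stronglyConnected : ∀ {k} → IsArcConnectivity X k → 1 ≤ k →
    ¬ ¬ StronglyConnected (Arc X)
  1≤arcConnectivity⇒¬¬stronglyConnected (_ , minimal) 1≤k ¬sc =
    n≮0 (subst (1 ≤_) (countPairs-none _ λ u v → ∧-zeroʳ (Arc X u v))
                       (≤-trans 1≤k (minimal (λ _ _ → false) (¬sc ∘ retract))))
    where
    walk : ∀ {u v} → Reach (removeArcs X λ _ _ → false) u v → Reach (Arc X) u v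
    walk here = here
    walk (step {u} {w} e r) = step (subst (_≡ true) (∧-identityʳ (Arc X u w)) e) (walk r)
    retract : StronglyConnected (removeArcs X λ _ _ → false) → StronglyConnected (Arc X)
    retract sc u v = walk (sc u v)

  T₀-crossing : ∀ {g h} → Reach (Arc X) (g , false) (h , true) → Nonempty T₀
  T₀-crossing (step {w = _ , false} _ r) = T₀-crossing r
  T₀-crossing (step {w = _ , true} e _)  = _ , e

  T₁-crossing : ∀ {g h} → Reach (Arc X) (g , true) (h , false) → Nonempty T₁
  T₁-crossing (step {w = _ , true} _ r)  = T₁-crossing r
  T₁-crossing (step {w = _ , false} e _) = _ , e

  group : Group _ _
  group = record { Carrier = Fin n ; _≈_ = _≡_ ; _∙_ = _∙_ ; ε = ε ; _⁻¹ = _⁻¹ ; isGroup = isGroup }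
  open Group group using (_\\_)
  open GroupProperties group using (//-rightDividesʳ; \\-leftDividesˡ; ⁻¹-anti-homo-\\)

  module Mates {t₀ t₁ : Fin n} (t₀∈T₀ : lookup T₀ t₀ ≡ true) (t₁∈T₁ : lookup T₁ t₁ ≡ true) where

    outMate inMate : Vertex n → Vertex n
    outMate (h , false) = t₀ ∙ h , true
    outMate (h , true)  = t₁ \\ h , false
    inMate (h , false)  = t₁ ∙ h , true
    inMate (h , true)   = t₀ \\ h , false

    outMate-layer : ∀ v → proj₂ (outMate v) ≡ not (proj₂ v)
    outMate-layer (_ , false) = refl
    outMate-layer (_ , true)  = refl

    inMate-layer : ∀ v → proj₂ (inMate v) ≡ not (proj₂ v)
    inMate-layer (_ , false) = refl
    inMate-layer (_ , true)  = refl

    private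
      ∈-shift : ∀ S {t} h → lookup S t ≡ true → lookup S ((t ∙ h) ∙ (h ⁻¹)) ≡ true
      ∈-shift S {t} h = subst (λ s → lookup S s ≡ true) (sym (//-rightDividesʳ h t))

      ∈-unshift : ∀ S {t} h → lookup S t ≡ true → lookup S (h ∙ ((t \\ h) ⁻¹)) ≡ true
      ∈-unshift S {t} h = subst (λ s → lookup S s ≡ true)
        (sym (trans (cong (h ∙_) (⁻¹-anti-homo-\\ t h)) (\\-leftDividesˡ h t)))

    outMate-arc : ∀ v → Arc X v (outMate v) ≡ true
    outMate-arc (h , false) = ∈-shift T₀ h t₀∈T₀
    outMate-arc (h , true)  = ∈-unshift T₁ h t₁∈T₁

    inMate-arc : ∀ v → Arc X (inMate v) v ≡ true
    inMate-arc (h , false) = ∈-shift T₁ h t₁∈T₁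
    inMate-arc (h , true)  = ∈-unshift T₀ h t₀∈T₀

  outward⇒2≤arcCount-ω⁺ : (S : VSet n) (f : Vertex n → Vertex n) →
    (∀ v → Arc X v (f v) ≡ true) → (∀ v → S v ≡ true → S (f v) ≡ false) →
    2 ≤ card S → 2 ≤ arcCount (ω⁺ X S)
  outward⇒2≤arcCount-ω⁺ S f arc leaves 2≤|S|
    with u , v , u≢v , u∈S , v∈S ← 2≤card⇒distinct S 2≤|S|
    = distinct⇒2≤countPairs (ω⁺ X S) {u} {f u} {v} {f v} (u≢v ∘ cong proj₁) (cut u u∈S) (cut v v∈S)
    where
    cut : ∀ w → S w ≡ true → ω⁺ X S w (f w) ≡ true
    cut w w∈S rewrite arc w | w∈S | leaves w w∈S = refl

  inward⇒2≤arcCount-ω⁻ : (S : VSet n) (f : Vertex n → Vertex n) →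
    (∀ v → Arc X (f v) v ≡ true) → (∀ v → S v ≡ true → S (f v) ≡ false) →
    2 ≤ card S → 2 ≤ arcCount (ω⁻ X S)
  inward⇒2≤arcCount-ω⁻ S f arc leaves 2≤|S|
    with u , v , u≢v , u∈S , v∈S ← 2≤card⇒distinct S 2≤|S|
    = distinct⇒2≤countPairs (ω⁻ X S) {f u} {u} {f v} {v} (u≢v ∘ cong proj₂) (cut u u∈S) (cut v v∈S)
    where
    cut : ∀ w → S w ≡ true → ω⁻ X S (f w) w ≡ true
    cut w w∈S rewrite arc w | w∈S | leaves w w∈S = refl

  missesLayer⇒2≤cuts : StronglyConnected (Arc X) → (S : VSet n) (b : Bool) → MissesLayer S b →
    2 ≤ card S → 2 ≤ arcCount (ω⁺ X S) × 2 ≤ arcCount (ω⁻ X S)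
  missesLayer⇒2≤cuts sc S b misses 2≤|S|
    with _ , t₀∈T₀ ← T₀-crossing (sc (ε , false) (ε , true))
       | _ , t₁∈T₁ ← T₁-crossing (sc (ε , true) (ε , false))
    = outward⇒2≤arcCount-ω⁺ S outMate outMate-arc (λ v → other-layer-outside S misses (outMate-layer v))
        2≤|S|
    , inward⇒2≤arcCount-ω⁻ S inMate inMate-arc (λ v → other-layer-outside S misses (inMate-layer v))
        2≤|S|
    where open Mates t₀∈T₀ t₁∈T₁

  arcFragment-meetsLayer : IsArcConnectivity X 1 → (S : VSet n) → IsArcFragment X 1 S → 2 ≤ card S →
    (b : Bool) → ¬ MissesLayer S b
  arcFragment-meetsLayer connectivity S fragment 2≤|S| b misses =
    1≤arcConnectivity⇒¬¬stronglyConnected connectivity (s≤s z≤n) λ sc →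
      let ω⁺≥2 , ω⁻≥2 = missesLayer⇒2≤cuts sc S b misses 2≤|S| in
      case fragment of λ where
        (inj₁ (_ , ω⁺≡1)) → 2≰1 (subst (2 ≤_) ω⁺≡1 ω⁺≥2)
        (inj₂ (_ , ω⁻≡1)) → 2≰1 (subst (2 ≤_) ω⁻≡1 ω⁻≥2)
    where
    2≰1 : ¬ 2 ≤ 1
    2≰1 (s≤s ())

lemma4p2 : (n : ℕ) (X : MixedCayleyData n) (k d : ℕ)
           → IsArcConnectivity X k → IsMinDegree X d
           → IsMaxLambda k d → ¬ IsSuperLambda X k
           → (A : VSet n) → IsLambdaSuperatom X k A
           → d ≡ 1
           → (Σ (Fin n) λ g → A (g , false) ≡ true) × (Σ (Fin n) λ g → A (g , true) ≡ true)
-- Only λ(X) = 1 and |A| ≥ 2 are needed: neither the minimality of A nor the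
-- failure of super-λ plays a role.
lemma4p2 n X k .k connectivity _ refl _ A (fragment , 2≤|A| , _) refl = meets false , meets true
  where
  meets : ∀ b → Σ (Fin n) λ g → A (g , b) ≡ true
  meets b with any? (λ g → A (g , b) ≟ true)
  ... | yes found = found
  ... | no none = ⊥-elim (arcFragment-meetsLayer X connectivity A fragment 2≤|A| b λ g → ¬-not (none ∘ (g ,_)))
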